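{- Let $q$ be such that a finite projective plane $\mathcal{P}$ of order $q$ exists, and let $P$ be the incidence graph of $\mathcal{P}$. Then $c_{2,2}(P)=2$, but $c_{2,2}(P\,\Box\,P)\ge q+1$.
   Context: All graphs are finite, undirected and reflexive. In the speed-$(2,2)$ Cops and Robbers game on a graph $G$, the cops first place themselves on vertices, then the robber places himself; play proceeds in rounds, each a cops' turn followed by a robber's turn. On the cops' turn each cop moves along a walk of length at most $2$ (possibly staying put); on the robber's turn he moves along a walk of length at most $2$ not passing through a cop-occupied vertex. The cops win if some cop occupies the robber's vertex; the robber wins if he evades forever. $c_{2,2}(G)$ is the minimum number of cops guaranteeing a win. A finite projective plane of order $q$ is a collection of points and lines such that each line is a set of $q+1$ points, each point lies on exactly $q+1$ lines, any two distinct lines share exactly one point, any two distinct points lie on exactly one common line, and there exist four points no three of which lie on a common line. Its incidence graph has a vertex for each point and each line, with a point adjacent to a line iff the point lies on the line. $\Box$ denotes the Cartesian product of graphs. -}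

module Defs where

open import Data.Nat using (ℕ; suc; _<_)
open import Data.Fin using (Fin)
open import Data.Bool using (Bool; T)
open import Data.Sum using (_⊎_; inj₁; inj₂)
open import Data.Product using (Σ; ∃; ∃!; _×_; _,_)
open import Data.Empty using (⊥)
open import Relation.Nullary using (¬_)
open import Relation.Binary.PropositionalEquality using (_≡_; _≢_)
open import Function.Bundles using (_↔_)

record Graph : Set₁ where
  field
    V    : Set
    _~_  : V → V → Set
    ~-refl : ∀ v → v ~ v
    ~-sym  : ∀ {u v} → u ~ v → v ~ u

module Game (G : Graph) where
  open Graph G

  -- a walk of length (exactly, equivalently at most, by reflexivity) 2
  -- through the middle vertex m
  Walk2 : V → V → Set
  Walk2 x y = Σ V λ m → x ~ m × m ~ y

  Occupied : ∀ {k} → (Fin k → V) → V → Set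
  Occupied c v = ∃ λ i → c i ≡ v

  CopsMove : ∀ {k} → (Fin k → V) → (Fin k → V) → Set
  CopsMove c c' = ∀ i → Walk2 (c i) (c' i)

  RobberMove : ∀ {k} → (Fin k → V) → V → V → Set
  RobberMove c r r' =
    Σ V λ m → r ~ m × m ~ r' × ¬ Occupied c m × ¬ Occupied c r'

  -- CopsWinFrom c r : cops at c, robber at r, cops to move; the cops can
  -- force a capture (least fixed point = capture in finitely many rounds)
  data CopsWinFrom {k : ℕ} (c : Fin k → V) (r : V) : Set where
    step : (c' : Fin k → V) → CopsMove c c' →
           (Occupied c' r ⊎ (∀ r' → RobberMove c' r r' → CopsWinFrom c' r')) →
           CopsWinFrom c r

  CopsWin : ℕ → Set
  CopsWin k = Σ (Fin k → V) λ c → ∀ r → Occupied c r ⊎ CopsWinFrom c r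

c22≡ : Graph → ℕ → Set
c22≡ G k = Game.CopsWin G k × (∀ j → j < k → ¬ Game.CopsWin G j)

c22≥ : Graph → ℕ → Set
c22≥ G k = ∀ j → j < k → ¬ Game.CopsWin G j

_□_ : Graph → Graph → Graph
G □ H = record
  { V = G.V × H.V
  ; _~_ = λ { (a , b) (a' , b') → (a ≡ a' × b H.~ b') ⊎ (a G.~ a' × b ≡ b') }
  ; ~-refl = λ { (a , b) → inj₁ (_≡_.refl , H.~-refl b) }
  ; ~-sym = λ { (inj₁ (_≡_.refl , h)) → inj₁ (_≡_.refl , H.~-sym h)
              ; (inj₂ (g , _≡_.refl)) → inj₂ (G.~-sym g , _≡_.refl) }
  }
  where
    module G = Graph G
    module H = Graph H

record ProjectivePlane (q : ℕ) : Set where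
  field
    nP nL : ℕ
    inc : Fin nP → Fin nL → Bool

  Incident : Fin nP → Fin nL → Set
  Incident p l = T (inc p l)

  field
    lineSize  : ∀ l → Fin (suc q) ↔ Σ (Fin nP) (λ p → Incident p l)
    pointDeg  : ∀ p → Fin (suc q) ↔ Σ (Fin nL) (λ l → Incident p l)
    linesMeet : ∀ l l' → l ≢ l' →
                ∃! {A = Fin nP} _≡_ (λ p → Incident p l × Incident p l')
    pointsJoin : ∀ p p' → p ≢ p' →
                 ∃! {A = Fin nL} _≡_ (λ l → Incident p l × Incident p' l)
    quadrangle : Σ (Fin 4 → Fin nP) λ f →
                 ∀ i j k → i ≢ j → j ≢ k → i ≢ k →
                 ¬ Σ (Fin nL) (λ l → Incident (f i) l × Incident (f j) l × Incident (f k) l)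

IncidenceGraph : ∀ {q} → ProjectivePlane q → Graph
IncidenceGraph P = record
  { V = Fin nP ⊎ Fin nL
  ; _~_ = adj
  ; ~-refl = λ { (inj₁ p) → _≡_.refl ; (inj₂ l) → _≡_.refl }
  ; ~-sym = λ { {inj₁ p} {inj₁ p'} _≡_.refl → _≡_.refl
              ; {inj₁ p} {inj₂ l} i → i
              ; {inj₂ l} {inj₁ p} i → i
              ; {inj₂ l} {inj₂ l'} _≡_.refl → _≡_.refl }
  }
  where
    open ProjectivePlane P
    adj : Fin nP ⊎ Fin nL → Fin nP ⊎ Fin nL → Set
    adj (inj₁ p) (inj₁ p') = p ≡ p'
    adj (inj₁ p) (inj₂ l)  = Incident p l
    adj (inj₂ l) (inj₁ p)  = Incident p l
    adj (inj₂ l) (inj₂ l') = l ≡ l'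

{-# OPTIONS --safe #-}

-- The robber survives by always moving to a vertex that no cop can reach in
-- one move. Two cops on a point and a line reach every vertex of the incidence
-- graph in one move, since any two points (and any two lines) are at distance
-- at most 2; a single cop is evaded using that every vertex has q + 1 ≥ 2
-- neighbours and the graph has no 4-cycles. In P □ P, whose factors have
-- minimum degree q + 1 and girth 6, a robber at (u , v) facing at most q cops
-- moves to (a , b) with a a neighbour of u and b a neighbour of v; each cop
-- rules out at most one choice of a and of b, so some choice leaves every cop
-- at distance at least 3.
module Submission where

open import Defs
open import Data.Nat using (ℕ; zero; suc; _<_; s≤s; z≤n)
open import Data.Fin using (Fin; zero; suc; fromℕ<)
open import Data.Fin.Properties using (any?; all?; ¬∀⟶∃¬; <⇒notInjective)
  renaming (_≟_ to _≟ᶠ_)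
open import Data.Bool using (T?)
open import Data.Bool.Properties using (T-irrelevant)
open import Data.Empty using (⊥-elim)
open import Data.Product using (Σ; ∃; ∃₂; _×_; _,_; proj₁; proj₂)
open import Data.Product.Properties using (Σ-≡,≡→≡; ×-≡,≡→≡)
open import Data.Sum using (_⊎_; inj₁; inj₂; fromInj₁)
open import Data.Sum.Properties using (≡-dec; inj₂-injective; inj₁-injective)
open import Data.Vec.Functional using (updateAt)
open import Data.Vec.Functional.Properties using (updateAt-updates; updateAt-minimal)
open import Function.Base using (_∘_; const)
open import Function.Bundles using (Inverse; Injection; _↔_)
open import Function.Definitions using (Injective)
open import Function.Properties.Inverse using (↔⇒↣)
open import Relation.Nullary using (¬_; yes; no; Irrelevant)
open import Relation.Binary.Definitions using (Decidable; DecidableEquality)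
open import Relation.Binary.PropositionalEquality

<⇒missesValue : ∀ {j n} → j < n → (f : Fin j → Fin n) → ∃ λ k → ∀ i → f i ≢ k
<⇒missesValue {n = n} j<n f with all? (λ k → any? (λ i → f i ≟ᶠ k))
... | yes hit = ⊥-elim (<⇒notInjective j<n section-injective)
  where
  section-injective : Injective _≡_ _≡_ (λ k → proj₁ (hit k))
  section-injective {k} {k′} eq =
    trans (sym (proj₂ (hit k))) (trans (cong f eq) (proj₂ (hit k′)))
... | no ¬hit with k , missed ← ¬∀⟶∃¬ n _ (λ k → any? (λ i → f i ≟ᶠ k)) ¬hit =
  k , λ i fi≡k → missed (i , fi≡k)

module RobberStrategies (G : Graph) where
  open Graph G
  open Game G

  Unreachable : ∀ {k} → (Fin k → V) → V → Set
  Unreachable c r = ∀ i → ¬ Walk2 (c i) r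

  walk2-refl : ∀ v → Walk2 v v
  walk2-refl v = v , ~-refl v , ~-refl v

  unreachable⇒unoccupied : ∀ {k} {c : Fin k → V} {r} → Unreachable c r → ¬ Occupied c r
  unreachable⇒unoccupied unreachable (i , refl) = unreachable i (walk2-refl _)

  EscapeStrategy : ℕ → Set
  EscapeStrategy k = ∀ (c : Fin k → V) r → ¬ Occupied c r →
                     ∃ λ r′ → RobberMove c r r′ × Unreachable c r′

  unreachable⇒¬caught : ∀ {k} {c c′ : Fin k → V} {r} →
                        Unreachable c r → CopsMove c c′ → ¬ Occupied c′ r
  unreachable⇒¬caught unreachable move (i , refl) = unreachable i (move i)

  unreachable⇒¬copsWinFrom : ∀ {k} → EscapeStrategy k →
                             ∀ {c : Fin k → V} {r} → Unreachable c r → ¬ CopsWinFrom c r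
  unreachable⇒¬copsWinFrom escape unreachable (step c′ move (inj₁ caught)) =
    unreachable⇒¬caught unreachable move caught
  unreachable⇒¬copsWinFrom escape {r = r} unreachable (step c′ move (inj₂ continue))
    with r′ , robberMove , unreachable′ ←
           escape c′ r (unreachable⇒¬caught unreachable move) =
    unreachable⇒¬copsWinFrom escape unreachable′ (continue r′ robberMove)

  escape⇒¬copsWin : ∀ {k} → EscapeStrategy k →
                    (∀ (c : Fin k → V) → ∃ λ r → ¬ Occupied c r) → ¬ CopsWin k
  escape⇒¬copsWin escape free (c , win)
    with r₀ , free₀ ← free c
    with r , _ , unreachable ← escape c r₀ free₀
    with win r
  ... | inj₁ occupied = unreachable⇒unoccupied unreachable occupied
  ... | inj₂ winFrom  = unreachable⇒¬copsWinFrom escape unreachable winFrom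

  ¬copsWin₀ : V → ¬ CopsWin 0
  ¬copsWin₀ v = escape⇒¬copsWin stay (λ _ → v , λ ())
    where
    stay : EscapeStrategy 0
    stay c r free = r , (r , ~-refl r , ~-refl r , free , free) , λ ()

  OneCopEscape : V → V → Set
  OneCopEscape x r = ∃₂ λ m r′ → r ~ m × m ~ r′ × x ≢ m × ¬ Walk2 x r′

  escapeStrategy₁ : (∀ {x r} → x ≢ r → OneCopEscape x r) → EscapeStrategy 1
  escapeStrategy₁ escape c r free
    with m , r′ , r~m , m~r′ , x≢m , unreachable ← escape (free ∘ (zero ,_)) =
    r′ , (m , r~m , m~r′ , (λ { (zero , x≡m) → x≢m x≡m })
                         , (λ { (zero , refl) → unreachable (walk2-refl r′) }))
       , λ { zero → unreachable }

  reachAll⇒copsWin : ∀ {k} (c : Fin k → V) → (∀ r → ∃ λ i → Walk2 (c i) r) → CopsWin k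
  reachAll⇒copsWin c reach = c , λ r →
    inj₂ (step (chase r) (move r) (inj₁ (catcher r , updateAt-updates (catcher r) c)))
    where
    catcher : ∀ r → Fin _
    catcher r = proj₁ (reach r)

    chase : V → Fin _ → V
    chase r = updateAt c (catcher r) (const r)

    move : ∀ r → CopsMove c (chase r)
    move r i with i ≟ᶠ catcher r
    ... | yes refl = subst (Walk2 (c i)) (sym (updateAt-updates i c)) (proj₂ (reach r))
    ... | no i≢catcher =
      subst (Walk2 (c i)) (sym (updateAt-minimal i _ c i≢catcher)) (walk2-refl (c i))

walk2-□ : ∀ (G H : Graph) {c₁ c₂ a b} → Game.Walk2 (G □ H) (c₁ , c₂) (a , b) →
          c₁ ≡ a ⊎ c₂ ≡ b ⊎ (Graph._~_ G c₁ a × Graph._~_ H c₂ b)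
walk2-□ G H ((_ , _) , inj₁ (refl , _) , inj₁ (refl , _)) = inj₁ refl
walk2-□ G H ((_ , _) , inj₂ (_ , refl) , inj₂ (_ , refl)) = inj₂ (inj₁ refl)
walk2-□ G H ((_ , _) , inj₁ (refl , c₂~m) , inj₂ (m~a , refl)) = inj₂ (inj₂ (m~a , c₂~m))
walk2-□ G H ((_ , _) , inj₂ (c₁~m , refl) , inj₁ (refl , m~b)) = inj₂ (inj₂ (c₁~m , m~b))

-- nbr u enumerates d distinct neighbours of u, and nbr-unique says that a
-- vertex c ≢ u is adjacent to at most one of them: G has minimum degree at
-- least d and neither triangles nor 4-cycles.
module Girth≥5
  (G : Graph)
  (_≟_ : DecidableEquality (Graph.V G))
  (_~?_ : Decidable (Graph._~_ G))
  {d : ℕ} (nbr : Graph.V G → Fin d → Graph.V G)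
  (nbr-adj : ∀ u k → Graph._~_ G u (nbr u k))
  (nbr-≢ : ∀ u k → nbr u k ≢ u)
  (nbr-unique : ∀ {u c k k′} → c ≢ u →
                Graph._~_ G (nbr u k) c → Graph._~_ G (nbr u k′) c → k ≡ k′)
  where
  open Graph G

  blocker : Fin d → (u c : V) → ∃ λ b → ∀ {k} → nbr u k ~ c → c ≡ u ⊎ k ≡ b
  blocker default u c with c ≟ u | any? (λ k → nbr u k ~? c)
  ... | yes c≡u | _            = default , λ _ → inj₁ c≡u
  ... | no c≢u  | yes (b , bc) = b , λ kc → inj₂ (nbr-unique c≢u kc bc)
  ... | no _    | no ¬adj      = default , λ kc → ⊥-elim (¬adj (_ , kc))

  avoidingNeighbour : ∀ {j} → j < d → (c : Fin j → V) (u : V) →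
                      ∃ λ k → ∀ i → nbr u k ~ c i → c i ≡ u
  avoidingNeighbour j<d c u
    with k , missed ← <⇒missesValue j<d (λ i → proj₁ (blocker (fromℕ< j<d) u (c i))) =
    k , λ i kc → fromInj₁ (λ k≡b → ⊥-elim (missed i (sym k≡b)))
                          (proj₂ (blocker (fromℕ< j<d) u (c i)) kc)

  ≢nbr : ∀ {u k x} → (nbr u k ~ x → x ≡ u) → x ≢ nbr u k
  ≢nbr avoids refl = nbr-≢ _ _ (avoids (~-refl _))

  open Game (G □ G)
  open RobberStrategies (G □ G)

  escape-□ : ∀ {j} → j < d → EscapeStrategy j
  escape-□ j<d c (u , v) free
    with k , avoidsᵤ ← avoidingNeighbour j<d (proj₁ ∘ c) u
       | l , avoidsᵥ ← avoidingNeighbour j<d (proj₂ ∘ c) v =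
    (a , b) , ((a , v) , inj₂ (nbr-adj u k , refl) , inj₁ (refl , nbr-adj v l)
                       , midFree , unreachable⇒unoccupied unreachable)
            , unreachable
    where
    a = nbr u k
    b = nbr v l

    midFree : ¬ Occupied c (a , v)
    midFree (i , ci≡av) = ≢nbr (avoidsᵤ i) (cong proj₁ ci≡av)

    unreachable : Unreachable c (a , b)
    unreachable i walk with walk2-□ G G walk
    ... | inj₁ c₁≡a = ≢nbr (avoidsᵤ i) c₁≡a
    ... | inj₂ (inj₁ c₂≡b) = ≢nbr (avoidsᵥ i) c₂≡b
    ... | inj₂ (inj₂ (c₁~a , c₂~b)) =
      free (i , ×-≡,≡→≡ (avoidsᵤ i (~-sym c₁~a) , avoidsᵥ i (~-sym c₂~b)))

  c22≥-□ : V → c22≥ (G □ G) d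
  c22≥-□ v j j<d = escape⇒¬copsWin (escape-□ j<d) free
    where
    free : ∀ c → ∃ λ r → ¬ Occupied c r
    free c with k , avoids ← avoidingNeighbour j<d (proj₁ ∘ c) v =
      (nbr v k , v) , λ (i , ci≡r) → ≢nbr (avoids i) (cong proj₁ ci≡r)

proj₁∘to-injective : ∀ {X A : Set} {B : A → Set} (e : X ↔ Σ A B) →
                     (∀ {a} → Irrelevant (B a)) →
                     Injective _≡_ _≡_ (proj₁ ∘ Inverse.to e)
proj₁∘to-injective e B-irrelevant eq =
  Injection.injective (↔⇒↣ e) (Σ-≡,≡→≡ (eq , B-irrelevant _ _))

module ProjectivePlaneFacts {q} (P : ProjectivePlane q) where
  open ProjectivePlane P

  lineThrough : Fin nP → Fin (suc q) → Fin nL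
  lineThrough p = proj₁ ∘ Inverse.to (pointDeg p)

  lineThrough-incident : ∀ p k → Incident p (lineThrough p k)
  lineThrough-incident p = proj₂ ∘ Inverse.to (pointDeg p)

  lineThrough-injective : ∀ p → Injective _≡_ _≡_ (lineThrough p)
  lineThrough-injective p = proj₁∘to-injective (pointDeg p) T-irrelevant

  pointOn : Fin nL → Fin (suc q) → Fin nP
  pointOn l = proj₁ ∘ Inverse.to (lineSize l)

  pointOn-incident : ∀ l k → Incident (pointOn l k) l
  pointOn-incident l = proj₂ ∘ Inverse.to (lineSize l)

  pointOn-injective : ∀ l → Injective _≡_ _≡_ (pointOn l)
  pointOn-injective l = proj₁∘to-injective (lineSize l) T-irrelevant

  pointOn-surjective : ∀ {p l} → Incident p l → ∃ λ k → pointOn l k ≡ p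
  pointOn-surjective {p} {l} i =
    Inverse.from (lineSize l) (p , i) ,
    cong proj₁ (Inverse.strictlyInverseˡ (lineSize l) (p , i))

  join-unique : ∀ {p p′ l l′} → p ≢ p′ → Incident p l → Incident p′ l →
                Incident p l′ → Incident p′ l′ → l ≡ l′
  join-unique p≢p′ i i′ j j′ with _ , _ , unique ← pointsJoin _ _ p≢p′ =
    trans (sym (unique (i , i′))) (unique (j , j′))

  meet-unique : ∀ {l l′ p p′} → l ≢ l′ → Incident p l → Incident p l′ →
                Incident p′ l → Incident p′ l′ → p ≡ p′
  meet-unique l≢l′ i i′ j j′ with _ , _ , unique ← linesMeet _ _ l≢l′ =
    trans (sym (unique (i , i′))) (unique (j , j′))

  commonLine : ∀ p p′ → ∃ λ l → Incident p l × Incident p′ l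
  commonLine p p′ with p ≟ᶠ p′
  ... | yes refl = lineThrough p zero , lineThrough-incident p zero ,
                   lineThrough-incident p zero
  ... | no p≢p′ with l , incident , _ ← pointsJoin p p′ p≢p′ = l , incident

  commonPoint : ∀ l l′ → ∃ λ p → Incident p l × Incident p l′
  commonPoint l l′ with l ≟ᶠ l′
  ... | yes refl = pointOn l zero , pointOn-incident l zero , pointOn-incident l zero
  ... | no l≢l′ with p , incident , _ ← linesMeet l l′ l≢l′ = p , incident

¬projectivePlane₀ : ¬ ProjectivePlane 0
¬projectivePlane₀ P = corner₀≢corner₁ corner₀≡corner₁
  where
  open ProjectivePlane P
  open ProjectivePlaneFacts P

  corner : Fin 4 → Fin nP
  corner = proj₁ quadrangle

  corner₀≢corner₁ : corner zero ≢ corner (suc zero)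
  corner₀≢corner₁ eq
    with l , i₀ , i₂ ← commonLine (corner zero) (corner (suc (suc zero))) =
    proj₂ quadrangle zero (suc zero) (suc (suc zero)) (λ ()) (λ ()) (λ ())
      (l , i₀ , subst (λ p → Incident p l) eq i₀ , i₂)

  corner₀≡corner₁ : corner zero ≡ corner (suc zero)
  corner₀≡corner₁
    with l , i₀ , i₁ ← commonLine (corner zero) (corner (suc zero))
    with pointOn-surjective i₀ | pointOn-surjective i₁
  ... | zero , on₀ | zero , on₁ = trans (sym on₀) on₁

order-positive : ∀ {q} → ProjectivePlane q → 1 < suc q
order-positive {zero}  P = ⊥-elim (¬projectivePlane₀ P)
order-positive {suc _} _ = s≤s (s≤s z≤n)

module IncidenceGraphFacts {q} (P : ProjectivePlane q) where
  open ProjectivePlane P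
  open ProjectivePlaneFacts P
  open Graph (IncidenceGraph P)
  open Game (IncidenceGraph P)
  open RobberStrategies (IncidenceGraph P)

  _≟_ : DecidableEquality V
  _≟_ = ≡-dec _≟ᶠ_ _≟ᶠ_

  _~?_ : Decidable _~_
  inj₁ p ~? inj₁ p′ = p ≟ᶠ p′
  inj₁ p ~? inj₂ l  = T? (inc p l)
  inj₂ l ~? inj₁ p  = T? (inc p l)
  inj₂ l ~? inj₂ l′ = l ≟ᶠ l′

  nbr : V → Fin (suc q) → V
  nbr (inj₁ p) k = inj₂ (lineThrough p k)
  nbr (inj₂ l) k = inj₁ (pointOn l k)

  nbr-adj : ∀ u k → u ~ nbr u k
  nbr-adj (inj₁ p) = lineThrough-incident p
  nbr-adj (inj₂ l) = pointOn-incident l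

  nbr-≢ : ∀ u k → nbr u k ≢ u
  nbr-≢ (inj₁ _) _ ()
  nbr-≢ (inj₂ _) _ ()

  nbr-unique : ∀ {u c k k′} → c ≢ u → nbr u k ~ c → nbr u k′ ~ c → k ≡ k′
  nbr-unique {inj₁ p} {inj₁ p′} c≢u i i′ = lineThrough-injective p
    (join-unique (c≢u ∘ cong inj₁ ∘ sym)
                 (lineThrough-incident p _) i (lineThrough-incident p _) i′)
  nbr-unique {inj₁ p} {inj₂ l} _ eq eq′ = lineThrough-injective p (trans eq (sym eq′))
  nbr-unique {inj₂ l} {inj₁ p} _ eq eq′ = pointOn-injective l (trans eq (sym eq′))
  nbr-unique {inj₂ l} {inj₂ l′} c≢u i i′ = pointOn-injective l
    (meet-unique (c≢u ∘ cong inj₂ ∘ sym)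
                 (pointOn-incident l _) i (pointOn-incident l _) i′)

  module Girth = Girth≥5 (IncidenceGraph P) _≟_ _~?_ nbr nbr-adj nbr-≢ nbr-unique

  nonAdjacentNeighbour : ∀ {u c} → c ≢ u → ∃ λ k → ¬ nbr u k ~ c
  nonAdjacentNeighbour {u} {c} c≢u
    with k , avoids ← Girth.avoidingNeighbour (order-positive P) (const c) u =
    k , c≢u ∘ avoids zero

  walk2-points : ∀ p p′ → Walk2 (inj₁ p) (inj₁ p′)
  walk2-points p p′ with l , i , i′ ← commonLine p p′ = inj₂ l , i , i′

  walk2-lines : ∀ l l′ → Walk2 (inj₂ l) (inj₂ l′)
  walk2-lines l l′ with p , i , i′ ← commonPoint l l′ = inj₁ p , i , i′

  walk2-point-line⇒incident : ∀ {p l} → Walk2 (inj₁ p) (inj₂ l) → Incident p l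
  walk2-point-line⇒incident (inj₁ _ , refl , i) = i
  walk2-point-line⇒incident (inj₂ _ , i , refl) = i

  walk2-line-point⇒incident : ∀ {p l} → Walk2 (inj₂ l) (inj₁ p) → Incident p l
  walk2-line-point⇒incident (inj₁ _ , i , refl) = i
  walk2-line-point⇒incident (inj₂ _ , refl , i) = i

  point₀ : Fin nP
  point₀ = proj₁ quadrangle zero

  line₀ : Fin nL
  line₀ = lineThrough point₀ zero

  copsWin₂ : CopsWin 2
  copsWin₂ = reachAll⇒copsWin cops reach
    where
    cops : Fin 2 → V
    cops zero       = inj₁ point₀
    cops (suc zero) = inj₂ line₀

    reach : ∀ r → ∃ λ i → Walk2 (cops i) r
    reach (inj₁ p) = zero , walk2-points point₀ p
    reach (inj₂ l) = suc zero , walk2-lines line₀ l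

  escape-viaOtherLine : ∀ {p L} → Incident p L → OneCopEscape (inj₂ L) (inj₁ p)
  escape-viaOtherLine {p} {L} p∈L
    with nonAdjacentNeighbour {inj₁ p} {inj₂ L} (λ ())
  ... | k , l≢L with nonAdjacentNeighbour {inj₂ (lineThrough p k)} {inj₁ p} (λ ())
  ... | k′ , y≢p = inj₂ l , inj₁ y , lineThrough-incident p k , pointOn-incident l k′
          , l≢L ∘ sym ∘ inj₂-injective , y∉L ∘ walk2-line-point⇒incident
    where
    l = lineThrough p k
    y = pointOn l k′

    y∉L : ¬ Incident y L
    y∉L y∈L = l≢L (join-unique (y≢p ∘ sym)
                     (lineThrough-incident p k) (pointOn-incident l k′) p∈L y∈L)

  escape-viaOtherPoint : ∀ {p l} → Incident p l → OneCopEscape (inj₁ p) (inj₂ l)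
  escape-viaOtherPoint {p} {l} p∈l
    with nonAdjacentNeighbour {inj₂ l} {inj₁ p} (λ ())
  ... | k , y≢p with nonAdjacentNeighbour {inj₁ (pointOn l k)} {inj₂ l} (λ ())
  ... | k′ , L≢l = inj₁ y , inj₂ L , pointOn-incident l k , lineThrough-incident y k′
          , y≢p ∘ sym ∘ inj₁-injective , p∉L ∘ walk2-point-line⇒incident
    where
    y = pointOn l k
    L = lineThrough y k′

    p∉L : ¬ Incident p L
    p∉L p∈L = y≢p (meet-unique (L≢l ∘ sym)
                     (pointOn-incident l k) (lineThrough-incident y k′) p∈l p∈L)

  escape : ∀ {x r} → x ≢ r → OneCopEscape x r
  escape {inj₁ p′} {inj₁ p} x≢r with k , p′∉l ← nonAdjacentNeighbour x≢r =
    inj₂ (lineThrough p k) , inj₂ (lineThrough p k) , lineThrough-incident p k , refl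
    , (λ ()) , p′∉l ∘ walk2-point-line⇒incident
  escape {inj₂ l′} {inj₂ l} x≢r with k , y∉l′ ← nonAdjacentNeighbour x≢r =
    inj₁ (pointOn l k) , inj₁ (pointOn l k) , pointOn-incident l k , refl
    , (λ ()) , y∉l′ ∘ walk2-line-point⇒incident
  escape {inj₂ L} {inj₁ p} x≢r with T? (inc p L)
  ... | yes p∈L = escape-viaOtherLine p∈L
  ... | no p∉L  =
    inj₁ p , inj₁ p , refl , refl , x≢r , p∉L ∘ walk2-line-point⇒incident
  escape {inj₁ p} {inj₂ l} x≢r with T? (inc p l)
  ... | yes p∈l = escape-viaOtherPoint p∈l
  ... | no p∉l  =
    inj₂ l , inj₂ l , refl , refl , x≢r , p∉l ∘ walk2-point-line⇒incident

  ¬copsWin₁ : ¬ CopsWin 1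
  ¬copsWin₁ = escape⇒¬copsWin (escapeStrategy₁ escape) λ c →
    nbr (c zero) zero , λ { (zero , eq) → nbr-≢ (c zero) zero (sym eq) }

  c22≡2 : c22≡ (IncidenceGraph P) 2
  c22≡2 = copsWin₂ , λ where
    zero          _ → ¬copsWin₀ (inj₁ point₀)
    (suc zero)    _ → ¬copsWin₁
    (suc (suc _)) (s≤s (s≤s ()))

  c22≥-□ : c22≥ (IncidenceGraph P □ IncidenceGraph P) (suc q)
  c22≥-□ = Girth.c22≥-□ (inj₁ point₀)

theorem3p4 : (q : ℕ) (P : ProjectivePlane q) →
    c22≡ (IncidenceGraph P) 2 × c22≥ (IncidenceGraph P □ IncidenceGraph P) (suc q)
theorem3p4 q P = c22≡2 , c22≥-□
  where open IncidenceGraphFacts P
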